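{- Let $S$ be a string of length $n>1$ as described in the context, let $i\in\{0,\dots,n-1\}$ and let $c_1<\dots<c_k$ ($k\ge 0$) be the children of $i$ in the $\mathrm{pss}$-tree. Then $$\mathcal{L}_i=S[i..\mathrm{nss}[i])=S[i]\,S[c_1..c_2)\cdots S[c_k..\mathrm{nss}[i])=S[i]\,\mathcal{L}_{c_1}\cdots\mathcal{L}_{c_k},$$ i.e. $\mathcal{L}_i$ is $S[i]$ concatenated with the Lyndon prefixes of the children of $i$ in increasing order (for $k=0$ this reads $\mathcal{L}_i=S[i]$).
   Context: $S$ is a string of length $n>1$ over a totally ordered alphabet $\Sigma$, zero-indexed, with $S[n-1]=\$$ and $S[k]>\$$ for all $k<n-1$. $S[a..b)=S[a]\cdots S[b-1]$. $S_i=S[i]\cdots S[n-1]$ ($S_n$ is empty); $\prec$ is the lexicographic order (a proper prefix is smaller). A non-empty string is a Lyndon word if it is lexicographically smaller than all its proper suffixes; $\mathcal{L}_i$ is the longest prefix of $S_i$ that is a Lyndon word. $\mathrm{nss}[i]=\min\{j\in\{i+1,\dots,n\}:S_j\prec S_i\}$; $\mathrm{pss}[k]=\max(\{j\in\{0,\dots,k-1\}:S_j\prec S_k\}\cup\{ -1\})$. The $\mathrm{pss}$-tree has nodes $\{ -1,0,\dots,n-1\}$, root $-1$, and the parent of $k\ge 0$ is $\mathrm{pss}[k]$. -}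

module Defs where

open import Level using (0ℓ)
open import Data.Nat using (ℕ; zero; suc; _+_; _∸_; _<_; _≤_)
open import Data.List using (List; []; _∷_; _++_; take; drop; length)
open import Data.Product using (Σ; _×_; ∃)
open import Relation.Binary.Core using (Rel)
open import Relation.Binary.PropositionalEquality using (_≡_; _≢_)
open import Relation.Nullary using (¬_)
open import Data.List.Relation.Binary.Lex.Strict using (Lex-<)

module Strings {A : Set} (_<ᶜ_ : Rel A 0ℓ) where

  _≺_ : List A → List A → Set
  _≺_ = Lex-< _≡_ _<ᶜ_

  sub : List A → ℕ → ℕ → List A
  sub S a b = take (b ∸ a) (drop a S)

  suf : List A → ℕ → List A
  suf S i = drop i S

  Lyndon : List A → Set
  Lyndon w = (w ≢ []) × (∀ j → 0 < j → j < length w → w ≺ drop j w)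

  IsPrefix : List A → List A → Set
  IsPrefix p w = ∃ λ r → p ++ r ≡ w

  LongestLyndonPrefix : List A → ℕ → List A → Set
  LongestLyndonPrefix S i p =
    IsPrefix p (suf S i) × Lyndon p ×
    (∀ q → IsPrefix q (suf S i) → Lyndon q → length q ≤ length p)

  IsNss : List A → ℕ → ℕ → Set
  IsNss S i j =
    i < j × j ≤ length S × suf S j ≺ suf S i ×
    (∀ j' → i < j' → j' < j → ¬ (suf S j' ≺ suf S i))

  -- j = pss[k], for the case j ≥ 0: j = max { j < k : S_j ≺ S_k }
  IsPss : List A → ℕ → ℕ → Set
  IsPss S k j =
    j < k × suf S j ≺ suf S k ×
    (∀ j' → j < j' → j' < k → ¬ (suf S j' ≺ suf S k))

  data Increasing : List ℕ → Set where
    []  : Increasing []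
    [_] : ∀ x → Increasing (x ∷ [])
    _∷_ : ∀ {x y xs} → x < y → Increasing (y ∷ xs) → Increasing (x ∷ y ∷ xs)

  segments : List A → List ℕ → ℕ → List A
  segments S []            e = []
  segments S (c ∷ [])      e = sub S c e
  segments S (c ∷ d ∷ cs)  e = sub S c d ++ segments S (d ∷ cs) e

  concatMap′ : (ℕ → List A) → List ℕ → List A
  concatMap′ L []       = []
  concatMap′ L (c ∷ cs) = L c ++ concatMap′ L cs

{-# OPTIONS --safe #-}
-- Let w = S[i..nss[i]).  A proper suffix of w starts at some i < p < nss[i], where S_i ≺ S_p;
-- comparing S_i with S_p on the |w| - (p - i) letters that fit in w shows w ≺ S[p..nss[i]),
-- since equality there would force S_{i+|w|-(p-i)} ≺ S_{nss[i]} ≺ S_i.  So w is Lyndon, and no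
-- longer prefix is, because its suffix from nss[i] is bounded by a prefix of S_{nss[i]} ≺ S_i.
-- Hence L_c = S[c..nss[c]) for every c.  The children of i are i + 1 (when i + 1 < nss[i]),
-- then nss of each child while it stays below nss[i]: a position k strictly between a child c
-- and nss[c] has S_c ≺ S_k, so pss[k] ≥ c > i.  This cuts S[i+1..nss[i]) into the L_c.
module Submission where

open import Defs
open import Level using (0ℓ)
open import Data.Nat using (ℕ; zero; suc; _+_; _∸_; _<_; _≤_; s≤s⁻¹)
open import Data.Nat.Properties
open import Data.List using (List; []; _∷_; _++_; length; take; drop)
open import Data.List.Properties
  using (length-take; length-drop; take-take; drop-drop; drop-all; take-[]; take++drop≡id; ++-identityʳ)
open import Data.List.Membership.Propositional using (_∈_)
open import Data.List.Relation.Unary.All using (All)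
open import Data.List.Relation.Unary.Any using (here; there)
open import Data.List.Relation.Binary.Lex.Core using (halt; this; next)
open import Data.List.Relation.Binary.Pointwise using (Pointwise-≡⇒≡; ≡⇒Pointwise-≡)
import Data.List.Relation.Binary.Lex.Strict as Lex
open import Data.Product using (_×_; _,_; proj₁; proj₂; ∃)
open import Data.Sum using (_⊎_; inj₁; inj₂; map₁)
open import Function using (_∘_)
open import Function.Bundles using (_⇔_; Equivalence)
open import Relation.Nullary using (¬_; yes; no; contradiction)
open import Relation.Unary using (Decidable)
open import Relation.Binary.Core using (Rel)
open import Relation.Binary.Structures using (IsStrictTotalOrder)
open import Relation.Binary.Definitions using (Trichotomous; tri<; tri≈; tri>)
open import Relation.Binary.Consequences using (tri⇒dec<)
open import Relation.Binary.PropositionalEquality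

module _ {P : ℕ → Set} (P? : Decidable P) where

  first-above : ∀ {k N} → k < N → P N →
    ∃ λ j → k < j × j ≤ N × P j × (∀ m → k < m → m < j → ¬ P m)
  first-above {k} {N} k<N PN = search k (N ∸ suc k) (m+[n∸m]≡n k<N)
    where
    search : ∀ k f → suc k + f ≡ N →
      ∃ λ j → k < j × j ≤ N × P j × (∀ m → k < m → m < j → ¬ P m)
    search k f 1+k+f≡N with P? (suc k)
    ... | yes P1+k = suc k , ≤-refl , subst (suc k ≤_) 1+k+f≡N (m≤m+n (suc k) f) , P1+k ,
                     λ m k<m m<1+k → contradiction (s≤s⁻¹ m<1+k) (<⇒≱ k<m)
    search k zero    1+k≡N   | no ¬P1+k = contradiction (subst P (sym (trans (sym (+-identityʳ (suc k))) 1+k≡N)) PN) ¬P1+k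
    search k (suc f) 1+k+f≡N | no ¬P1+k with search (suc k) f (trans (sym (+-suc (suc k) f)) 1+k+f≡N)
    ... | j , 1+k<j , j≤N , Pj , below = j , <-trans (n<1+n k) 1+k<j , j≤N , Pj , below′
      where
      below′ : ∀ m → k < m → m < j → ¬ P m
      below′ m k<m m<j with m≤n⇒m<n∨m≡n k<m
      ... | inj₁ 1+k<m = below m 1+k<m m<j
      ... | inj₂ refl  = ¬P1+k

module _ {A : Set} where

  drop-take : ∀ d ℓ (x : List A) → drop d (take ℓ x) ≡ take (ℓ ∸ d) (drop d x)
  drop-take zero    ℓ       x        = refl
  drop-take (suc d) zero    x        = refl
  drop-take (suc d) (suc ℓ) []       = sym (take-[] (ℓ ∸ d))
  drop-take (suc d) (suc ℓ) (y ∷ ys) = drop-take d ℓ ys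

  take++take-drop : ∀ m r (x : List A) → take m x ++ take r (drop m x) ≡ take (m + r) x
  take++take-drop zero    r x        = refl
  take++take-drop (suc m) r []       = take-[] r
  take++take-drop (suc m) r (y ∷ ys) = cong (y ∷_) (take++take-drop m r ys)

  take-length-++ : ∀ (p r : List A) → take (length p) (p ++ r) ≡ p
  take-length-++ []      r = refl
  take-length-++ (a ∷ p) r = cong (a ∷_) (take-length-++ p r)

  length-take-≤ : ∀ {m} {x : List A} → m ≤ length x → length (take m x) ≡ m
  length-take-≤ {m} {x} m≤|x| = trans (length-take m x) (m≤n⇒m⊓n≡m m≤|x|)

module LexOrder {A : Set} (_<ᶜ_ : Rel A 0ℓ) (sto : IsStrictTotalOrder _≡_ _<ᶜ_) where
  open Strings _<ᶜ_
  open IsStrictTotalOrder sto using (compare) renaming (irrefl to <ᶜ-irrefl; trans to <ᶜ-trans)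

  ≺-irrefl : ∀ {x} → ¬ (x ≺ x)
  ≺-irrefl = Lex.<-irreflexive <ᶜ-irrefl (≡⇒Pointwise-≡ refl)

  ≺-trans : ∀ {x y z} → x ≺ y → y ≺ z → x ≺ z
  ≺-trans = Lex.<-transitive isEquivalence (resp₂ _<ᶜ_) <ᶜ-trans

  ≺-asym : ∀ {x y} → x ≺ y → ¬ (y ≺ x)
  ≺-asym x≺y y≺x = ≺-irrefl (≺-trans x≺y y≺x)

  ≺-compare : Trichotomous _≡_ _≺_
  ≺-compare x y with Lex.<-compare sym compare x y
  ... | tri< a ¬b ¬c = tri< a (¬b ∘ ≡⇒Pointwise-≡) ¬c
  ... | tri≈ ¬a b ¬c = tri≈ ¬a (Pointwise-≡⇒≡ b) ¬c
  ... | tri> ¬a ¬b c = tri> ¬a (¬b ∘ ≡⇒Pointwise-≡) c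

  _≼_ : List A → List A → Set
  x ≼ y = x ≺ y ⊎ x ≡ y

  ≼-≺-trans : ∀ {x y z} → x ≼ y → y ≺ z → x ≺ z
  ≼-≺-trans (inj₁ x≺y) y≺z = ≺-trans x≺y y≺z
  ≼-≺-trans (inj₂ refl) y≺z = y≺z

  ≼-trans : ∀ {x y z} → x ≼ y → y ≼ z → x ≼ z
  ≼-trans x≼y (inj₁ y≺z) = inj₁ (≼-≺-trans x≼y y≺z)
  ≼-trans x≼y (inj₂ refl) = x≼y

  ∷-mono-≼ : ∀ a {u v} → u ≼ v → (a ∷ u) ≼ (a ∷ v)
  ∷-mono-≼ a (inj₁ u≺v) = inj₁ (next refl u≺v)
  ∷-mono-≼ a (inj₂ u≡v) = inj₂ (cong (a ∷_) u≡v)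

  take-≼ : ∀ k x → take k x ≼ x
  take-≼ zero    []       = inj₂ refl
  take-≼ zero    (a ∷ x)  = inj₁ halt
  take-≼ (suc k) []       = inj₂ refl
  take-≼ (suc k) (a ∷ x)  = ∷-mono-≼ a (take-≼ k x)

  take-mono-≼ : ∀ m {x y} → x ≺ y → take m x ≼ take m y
  take-mono-≼ zero    _                  = inj₂ refl
  take-mono-≼ (suc m) halt               = inj₁ halt
  take-mono-≼ (suc m) (this a<b)         = inj₁ (this a<b)
  take-mono-≼ (suc m) (next {x = a} refl x≺y) = ∷-mono-≼ a (take-mono-≼ m x≺y)

  ++-mono-≺ : ∀ {u v} x y → u ≺ v → length u ≡ length v → (u ++ x) ≺ (v ++ y)
  ++-mono-≺ x y halt           ()
  ++-mono-≺ x y (this a<b)     _   = this a<b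
  ++-mono-≺ x y (next refl u≺v) eq = next refl (++-mono-≺ x y u≺v (suc-injective eq))

  ++-cancelˡ-≺ : ∀ v {x y} → (v ++ x) ≺ (v ++ y) → x ≺ y
  ++-cancelˡ-≺ []      x≺y            = x≺y
  ++-cancelˡ-≺ (a ∷ v) (this a<a)     = contradiction a<a (<ᶜ-irrefl refl)
  ++-cancelˡ-≺ (a ∷ v) (next _ vx≺vy) = ++-cancelˡ-≺ v vx≺vy

module LyndonPrefixes {A : Set} (_<ᶜ_ : Rel A 0ℓ) (sto : IsStrictTotalOrder _≡_ _<ᶜ_) where
  open Strings _<ᶜ_
  open LexOrder _<ᶜ_ sto

  prefix-≡-take : ∀ {p X} → IsPrefix p X → p ≡ take (length p) X
  prefix-≡-take {p} (r , refl) = sym (take-length-++ p r)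

  take-Lyndon : ∀ {X} ℓ → 0 < ℓ → ℓ ≤ length X → drop ℓ X ≺ X →
    (∀ d → 0 < d → d < ℓ → X ≺ drop d X) → Lyndon (take ℓ X)
  take-Lyndon {X} ℓ 0<ℓ ℓ≤|X| dropℓ≺X X≺drop = nonEmpty , smaller-than-suffixes
    where
    |w|≡ℓ : length (take ℓ X) ≡ ℓ
    |w|≡ℓ = length-take-≤ ℓ≤|X|

    nonEmpty : take ℓ X ≢ []
    nonEmpty w≡[] = <⇒≢ 0<ℓ (trans (sym (cong length w≡[])) |w|≡ℓ)

    smaller-than-suffixes : ∀ d → 0 < d → d < length (take ℓ X) → take ℓ X ≺ drop d (take ℓ X)
    smaller-than-suffixes d 0<d d<|w| = proper-suffix d 0<d (subst (d <_) |w|≡ℓ d<|w|)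
      where
      -- compare X with its shift by d on the m = ℓ - d letters that stay inside the window
      module ShiftBy (d : ℕ) (0<d : 0 < d) (d<ℓ : d < ℓ) where
        m : ℕ
        m = ℓ ∸ d

        from-strict : take m X ≺ take m (drop d X) → take ℓ X ≺ drop d (take ℓ X)
        from-strict head≺ = subst₂ _≺_ w≡ (trans (++-identityʳ _) (sym (drop-take d ℓ X)))
                              (++-mono-≺ (take d (drop m X)) [] head≺ (trans |head| (sym |head′|)))
          where
          w≡ : take m X ++ take d (drop m X) ≡ take ℓ X
          w≡ = trans (take++take-drop m d X) (cong (λ t → take t X) (m∸n+n≡m (<⇒≤ d<ℓ)))
          |head| : length (take m X) ≡ m
          |head| = length-take-≤ (≤-trans (m∸n≤m ℓ d) ℓ≤|X|)
          |head′| : length (take m (drop d X)) ≡ m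
          |head′| = length-take-≤ (subst (m ≤_) (sym (length-drop d X)) (∸-monoˡ-≤ d ℓ≤|X|))

        -- equal heads would leave drop m X and drop ℓ X as the tails behind a common word
        heads-differ : take m X ≢ take m (drop d X)
        heads-differ head≡ = ≺-irrefl (≺-trans (X≺drop m 0<m m<ℓ) (≺-trans dropm≺dropℓ dropℓ≺X))
          where
          0<m : 0 < m
          0<m = m<n⇒0<n∸m d<ℓ
          m<ℓ : m < ℓ
          m<ℓ = ∸-monoʳ-< 0<d (<⇒≤ d<ℓ)
          v : List A
          v = take m (drop d X)
          X≡ : X ≡ v ++ drop m X
          X≡ = trans (sym (take++drop≡id m X)) (cong (_++ drop m X) head≡)
          dropd≡ : drop d X ≡ v ++ drop ℓ X
          dropd≡ = trans (sym (take++drop≡id m (drop d X)))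
                     (cong (v ++_) (trans (drop-drop d m X) (cong (λ t → drop t X) (m+[n∸m]≡n (<⇒≤ d<ℓ)))))
          dropm≺dropℓ : drop m X ≺ drop ℓ X
          dropm≺dropℓ = ++-cancelˡ-≺ v (subst₂ _≺_ X≡ dropd≡ (X≺drop d 0<d d<ℓ))

      proper-suffix : ∀ d → 0 < d → d < ℓ → take ℓ X ≺ drop d (take ℓ X)
      proper-suffix d 0<d d<ℓ with take-mono-≼ (ℓ ∸ d) (X≺drop d 0<d d<ℓ)
      ... | inj₁ head≺ = ShiftBy.from-strict d 0<d d<ℓ head≺
      ... | inj₂ head≡ = contradiction head≡ (ShiftBy.heads-differ d 0<d d<ℓ)

  LyndonPrefix-length≤ : ∀ {X} ℓ → drop ℓ X ≺ X → ∀ {q} → IsPrefix q X → Lyndon q → length q ≤ ℓ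
  LyndonPrefix-length≤ {X} ℓ dropℓ≺X {q} q⊑X (_ , q≺suffixes) =
    ≮⇒≥ λ ℓ<|q| → ≺-irrefl (≼-≺-trans dropℓq≼q (q≺suffixes ℓ 0<ℓ ℓ<|q|))
    where
    0<ℓ : 0 < ℓ
    0<ℓ = n≢0⇒n>0 λ { refl → ≺-irrefl dropℓ≺X }
    t r : ℕ
    t = length q
    r = t ∸ ℓ
    q≡ : q ≡ take t X
    q≡ = prefix-≡-take q⊑X
    dropℓq≡ : drop ℓ q ≡ take r (drop ℓ X)
    dropℓq≡ = trans (cong (drop ℓ) q≡) (drop-take ℓ t X)
    take-r≡ : take r X ≡ take r q
    take-r≡ = sym (trans (cong (take r) q≡) (trans (take-take r t X) (cong (λ s → take s X) (m≤n⇒m⊓n≡m (m∸n≤m t ℓ)))))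
    dropℓq≼q : drop ℓ q ≼ q
    dropℓq≼q = ≼-trans (subst₂ _≼_ (sym dropℓq≡) take-r≡ (take-mono-≼ r dropℓ≺X)) (take-≼ r q)

  longestLyndonPrefix≡take : ∀ {X p} ℓ → 0 < ℓ → ℓ ≤ length X → drop ℓ X ≺ X →
    (∀ d → 0 < d → d < ℓ → X ≺ drop d X) →
    IsPrefix p X → Lyndon p → (∀ q → IsPrefix q X → Lyndon q → length q ≤ length p) →
    p ≡ take ℓ X
  longestLyndonPrefix≡take {X} {p} ℓ 0<ℓ ℓ≤|X| dropℓ≺X X≺drop p⊑X p-Lyndon p-longest =
    trans (prefix-≡-take p⊑X) (cong (λ t → take t X) (≤-antisym |p|≤ℓ ℓ≤|p|))
    where
    |p|≤ℓ : length p ≤ ℓ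
    |p|≤ℓ = LyndonPrefix-length≤ ℓ dropℓ≺X p⊑X p-Lyndon
    ℓ≤|p| : ℓ ≤ length p
    ℓ≤|p| = subst (_≤ length p) (length-take-≤ ℓ≤|X|)
              (p-longest (take ℓ X) (drop ℓ X , take++drop≡id ℓ X) (take-Lyndon ℓ 0<ℓ ℓ≤|X| dropℓ≺X X≺drop))

module Suffixes {A : Set} (_<ᶜ_ : Rel A 0ℓ) (sto : IsStrictTotalOrder _≡_ _<ᶜ_) (S : List A) where
  open Strings _<ᶜ_
  open LexOrder _<ᶜ_ sto
  open LyndonPrefixes _<ᶜ_ sto

  n : ℕ
  n = length S

  suf-injective : ∀ {a b} → a ≤ n → b ≤ n → suf S a ≡ suf S b → a ≡ b
  suf-injective {a} {b} a≤n b≤n eq =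
    ∸-cancelˡ-≡ a≤n b≤n (trans (sym (length-drop a S)) (trans (cong length eq) (length-drop b S)))

  suf-≮⇒≻ : ∀ {a b} → a ≢ b → a ≤ n → b ≤ n → ¬ (suf S a ≺ suf S b) → suf S b ≺ suf S a
  suf-≮⇒≻ {a} {b} a≢b a≤n b≤n a⊀b with ≺-compare (suf S a) (suf S b)
  ... | tri< a≺b _ _ = contradiction a≺b a⊀b
  ... | tri≈ _ a≡b _ = contradiction (suf-injective a≤n b≤n a≡b) a≢b
  ... | tri> _ _ b≺a = b≺a

  sub-++ : ∀ {a b c} → a ≤ b → b ≤ c → sub S a b ++ sub S b c ≡ sub S a c
  sub-++ {a} {b} {c} a≤b b≤c = begin
    take (b ∸ a) (drop a S) ++ take (c ∸ b) (drop b S)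
      ≡⟨ cong (λ x → take (b ∸ a) (drop a S) ++ take (c ∸ b) x) drop-b≡ ⟩
    take (b ∸ a) (drop a S) ++ take (c ∸ b) (drop (b ∸ a) (drop a S))
      ≡⟨ take++take-drop (b ∸ a) (c ∸ b) (drop a S) ⟩
    take ((b ∸ a) + (c ∸ b)) (drop a S)
      ≡⟨ cong (λ t → take t (drop a S)) lengths ⟩
    take (c ∸ a) (drop a S) ∎
    where
    open ≡-Reasoning
    drop-b≡ : drop b S ≡ drop (b ∸ a) (drop a S)
    drop-b≡ = sym (trans (drop-drop a (b ∸ a) S) (cong (λ t → drop t S) (m+[n∸m]≡n a≤b)))
    lengths : (b ∸ a) + (c ∸ b) ≡ c ∸ a
    lengths = +-cancelˡ-≡ a _ _ (begin
      a + ((b ∸ a) + (c ∸ b)) ≡⟨ sym (+-assoc a (b ∸ a) (c ∸ b)) ⟩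
      a + (b ∸ a) + (c ∸ b)   ≡⟨ cong (_+ (c ∸ b)) (m+[n∸m]≡n a≤b) ⟩
      b + (c ∸ b)             ≡⟨ m+[n∸m]≡n b≤c ⟩
      c                       ≡⟨ sym (m+[n∸m]≡n (≤-trans a≤b b≤c)) ⟩
      a + (c ∸ a)             ∎)

  []≺suf : ∀ {k} → k < n → [] ≺ suf S k
  []≺suf {k} k<n with drop k S in eq
  ... | []    = contradiction (trans (sym (length-drop k S)) (cong length eq)) (m>n⇒m∸n≢0 k<n)
  ... | _ ∷ _ = halt

  nss-exists : ∀ {k} → k < n → ∃ (IsNss S k)
  nss-exists {k} k<n = first-above (λ j → tri⇒dec< ≺-compare (suf S j) (suf S k)) k<n Sn≺Sk
    where
    Sn≺Sk : suf S n ≺ suf S k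
    Sn≺Sk = subst (_≺ suf S k) (sym (drop-all n S ≤-refl)) ([]≺suf k<n)

  longestLyndonPrefix-ends-at-nss : ∀ {k j p} → IsNss S k j → LongestLyndonPrefix S k p → p ≡ sub S k j
  longestLyndonPrefix-ends-at-nss {k} {j} (k<j , j≤n , Sj≺Sk , below) (p⊑Sk , p-Lyndon , p-longest) =
    longestLyndonPrefix≡take ℓ (m<n⇒0<n∸m k<j) ℓ≤|Sk| dropℓ≺Sk Sk≺dropd p⊑Sk p-Lyndon p-longest
    where
    ℓ : ℕ
    ℓ = j ∸ k
    ℓ≤|Sk| : ℓ ≤ length (suf S k)
    ℓ≤|Sk| = subst (ℓ ≤_) (sym (length-drop k S)) (∸-monoˡ-≤ k j≤n)
    dropℓ≺Sk : drop ℓ (suf S k) ≺ suf S k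
    dropℓ≺Sk = subst (_≺ suf S k) (sym (trans (drop-drop k ℓ S) (cong (λ t → drop t S) (m+[n∸m]≡n (<⇒≤ k<j))))) Sj≺Sk
    Sk≺dropd : ∀ d → 0 < d → d < ℓ → suf S k ≺ drop d (suf S k)
    Sk≺dropd d 0<d d<ℓ = subst (suf S k ≺_) (sym (drop-drop k d S))
      (suf-≮⇒≻ (<⇒≢ k<k+d ∘ sym) (≤-trans (<⇒≤ k+d<j) j≤n) (≤-trans (<⇒≤ (<-trans k<k+d k+d<j)) j≤n)
        (below (k + d) k<k+d k+d<j))
      where
      k<k+d : k < k + d
      k<k+d = m<m+n k 0<d
      k+d<j : k + d < j
      k+d<j = subst (_≤ j) (cong suc (+-comm d k)) (m≤o∸n⇒m+n≤o (suc d) (<⇒≤ k<j) d<ℓ)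

  head<tail : ∀ {c cs k} → Increasing (c ∷ cs) → k ∈ cs → c < k
  head<tail (c<c′ ∷ _)   (here refl) = c<c′
  head<tail (c<c′ ∷ inc) (there k∈)  = <-trans c<c′ (head<tail inc k∈)

  tail-increasing : ∀ {c cs} → Increasing (c ∷ cs) → Increasing cs
  tail-increasing [ _ ]     = []
  tail-increasing (_ ∷ inc) = inc

  module Children {i j : ℕ} (i<j : i < j) (j≤n : j ≤ n) (Sj≺Si : suf S j ≺ suf S i)
                  (below-j : ∀ k → i < k → k < j → ¬ (suf S k ≺ suf S i)) where

    IsChild : ℕ → Set
    IsChild k = k < n × IsPss S k i

    child<nss : ∀ {k} → IsChild k → k < j
    child<nss {k} (_ , i<k , Si≺Sk , between) with <-cmp k j
    ... | tri< k<j _ _ = k<j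
    ... | tri≈ _ refl _ = contradiction Sj≺Si (≺-asym Si≺Sk)
    ... | tri> _ _ j<k = contradiction (≺-trans Sj≺Si Si≺Sk) (between j i<j j<k)

    suc-isChild : suc i < j → IsChild (suc i)
    suc-isChild 1+i<j =
      <-≤-trans 1+i<j j≤n , n<1+n i ,
      suf-≮⇒≻ (<⇒≢ (n<1+n i) ∘ sym) (≤-trans (<⇒≤ 1+i<j) j≤n) (≤-trans (<⇒≤ i<j) j≤n) (below-j (suc i) (n<1+n i) 1+i<j) ,
      λ k i<k k<1+i → contradiction (s≤s⁻¹ k<1+i) (<⇒≱ i<k)

    nss-of-child≤nss : ∀ {c d} → IsChild c → IsNss S c d → d ≤ j
    nss-of-child≤nss c-child@(_ , _ , Si≺Sc , _) (_ , _ , _ , below-d) =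
      ≮⇒≥ λ j<d → below-d j (child<nss c-child) j<d (≺-trans Sj≺Si Si≺Sc)

    nss-of-child-isChild : ∀ {c d} → IsChild c → IsNss S c d → d < j → IsChild d
    nss-of-child-isChild {c} {d} (c<n , i<c , _ , between-c) (c<d , d≤n , Sd≺Sc , below-d) d<j =
      <-≤-trans d<j j≤n , i<d ,
      suf-≮⇒≻ (<⇒≢ i<d ∘ sym) d≤n (≤-trans (<⇒≤ i<d) d≤n) (below-j d i<d d<j) ,
      between-d
      where
      i<d : i < d
      i<d = <-trans i<c c<d
      cycle : ∀ {k} → k ≢ c → k < d → ¬ (suf S k ≺ suf S c) → ¬ (suf S k ≺ suf S d)
      cycle k≢c k<d Sk⊀Sc Sk≺Sd =
        ≺-irrefl (≺-trans (≺-trans (suf-≮⇒≻ k≢c (≤-trans (<⇒≤ k<d) d≤n) (<⇒≤ c<n) Sk⊀Sc) Sk≺Sd) Sd≺Sc)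
      between-d : ∀ k → i < k → k < d → ¬ (suf S k ≺ suf S d)
      between-d k i<k k<d with <-cmp k c
      ... | tri≈ _ refl _ = λ Sk≺Sd → ≺-asym Sk≺Sd Sd≺Sc
      ... | tri< k<c _ _ = cycle (<⇒≢ k<c) k<d (between-c k i<k k<c)
      ... | tri> _ _ c<k = cycle (<⇒≢ c<k ∘ sym) k<d (below-d k c<k k<d)

    no-child-before-nss : ∀ {c d k} → IsChild c → IsNss S c d → c < k → k < d → ¬ IsChild k
    no-child-before-nss (_ , i<c , _ , _) (_ , d≤n , _ , below-d) c<k k<d (_ , _ , _ , between-k) =
      between-k _ i<c c<k
        (suf-≮⇒≻ (<⇒≢ c<k ∘ sym) (≤-trans (<⇒≤ k<d) d≤n) (≤-trans (<⇒≤ (<-trans c<k k<d)) d≤n) (below-d _ c<k k<d))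

    record ChildrenFrom (p : ℕ) (cs : List ℕ) : Set where
      field
        increasing : Increasing cs
        sound      : ∀ {k} → k ∈ cs → IsChild k × p ≤ k
        complete   : ∀ {k} → IsChild k → p ≤ k → k ∈ cs
    open ChildrenFrom

    ChildrenFrom-nss : ∀ {cs} → ChildrenFrom j cs → cs ≡ []
    ChildrenFrom-nss {[]}    _    = refl
    ChildrenFrom-nss {c ∷ _} from with sound from (here refl)
    ... | c-child , j≤c = contradiction (child<nss c-child) (≤⇒≯ j≤c)

    ChildrenFrom-head : ∀ {p c cs} → ChildrenFrom p (c ∷ cs) → IsChild p → c ≡ p
    ChildrenFrom-head {p} {c} from p-child with complete from p-child ≤-refl
    ... | here p≡c = sym p≡c
    ... | there p∈cs = contradiction (proj₂ (sound from (here refl))) (<⇒≱ (head<tail (increasing from) p∈cs))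

    ChildrenFrom-tail : ∀ {p cs d} → ChildrenFrom p (p ∷ cs) → IsChild p → IsNss S p d → ChildrenFrom d cs
    ChildrenFrom-tail {p} {cs} {d} from p-child p-nss@(p<d , _) = record
      { increasing = tail-increasing (increasing from)
      ; sound      = λ k∈cs → let k-child , _ = sound from (there k∈cs) in
                       k-child , ≮⇒≥ (λ k<d → no-child-before-nss p-child p-nss (p<k k∈cs) k<d k-child)
      ; complete   = λ k-child d≤k → drop-head (complete from k-child (≤-trans (<⇒≤ p<d) d≤k)) d≤k
      }
      where
      p<k : ∀ {k} → k ∈ cs → p < k
      p<k = head<tail (increasing from)
      drop-head : ∀ {k} → k ∈ p ∷ cs → d ≤ k → k ∈ cs
      drop-head (here refl) d≤p = contradiction d≤p (<⇒≱ p<d)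
      drop-head (there k∈cs) _  = k∈cs

    data NssChain : ℕ → List ℕ → Set where
      done : NssChain j []
      step : ∀ {p d cs} → IsNss S p d → NssChain d cs → NssChain p (p ∷ cs)

    NssChain-≤ : ∀ {p cs} → NssChain p cs → p ≤ j
    NssChain-≤ done                  = ≤-refl
    NssChain-≤ (step (p<d , _) rest) = ≤-trans (<⇒≤ p<d) (NssChain-≤ rest)

    segments-NssChain : ∀ {p cs} → NssChain p cs → segments S cs j ≡ sub S p j
    segments-NssChain done = cong (λ t → take t (drop j S)) (sym (n∸n≡0 j))
    segments-NssChain (step _ done) = refl
    segments-NssChain {p} (step {d = d} (p<d , _) rest@(step {cs = cs} _ _)) = begin
      sub S p d ++ segments S (d ∷ cs) j ≡⟨ cong (sub S p d ++_) (segments-NssChain rest) ⟩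
      sub S p d ++ sub S d j             ≡⟨ sub-++ (<⇒≤ p<d) (NssChain-≤ rest) ⟩
      sub S p j                          ∎
      where open ≡-Reasoning

    concatMap-NssChain : (L : ℕ → List A) → (∀ k → k < n → LongestLyndonPrefix S k (L k)) →
      ∀ {p cs} → NssChain p cs → concatMap′ L cs ≡ segments S cs j
    concatMap-NssChain L L-longest done = refl
    concatMap-NssChain L L-longest (step p-nss@(p<d , d≤n , _) done) =
      trans (++-identityʳ _) (longestLyndonPrefix-ends-at-nss p-nss (L-longest _ (<-≤-trans p<d d≤n)))
    concatMap-NssChain L L-longest (step p-nss@(p<d , d≤n , _) rest@(step _ _)) =
      cong₂ _++_ (longestLyndonPrefix-ends-at-nss p-nss (L-longest _ (<-≤-trans p<d d≤n)))
                 (concatMap-NssChain L L-longest rest)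

    children-NssChain : ∀ {p cs} → ChildrenFrom p cs → IsChild p ⊎ p ≡ j → NssChain p cs
    children-NssChain {cs = []}    _    (inj₂ refl)    = done
    children-NssChain {cs = []}    from (inj₁ p-child) with complete from p-child ≤-refl
    ... | ()
    children-NssChain {cs = _ ∷ _} from (inj₂ refl)    with ChildrenFrom-nss from
    ... | ()
    children-NssChain {p} {c ∷ cs} from (inj₁ p-child) with ChildrenFrom-head from p-child
    ... | refl with nss-exists (proj₁ p-child)
    ... | d , p-nss = step p-nss (children-NssChain (ChildrenFrom-tail from p-child p-nss) d-child-or-nss)
      where
      d-child-or-nss : IsChild d ⊎ d ≡ j
      d-child-or-nss with m≤n⇒m<n∨m≡n (nss-of-child≤nss p-child p-nss)
      ... | inj₁ d<j = inj₁ (nss-of-child-isChild p-child p-nss d<j)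
      ... | inj₂ d≡j = inj₂ d≡j

lemma4 : {A : Set} (_<ᶜ_ : Rel A 0ℓ) → IsStrictTotalOrder _≡_ _<ᶜ_ →
    (S T : List A) (dollar : A) → S ≡ T ++ (dollar ∷ []) → All (dollar <ᶜ_) T →
    1 < length S →
    (i : ℕ) → i < length S →
    (cs : List ℕ) → Strings.Increasing _<ᶜ_ cs →
    (∀ k → (k ∈ cs) ⇔ (k < length S × Strings.IsPss _<ᶜ_ S k i)) →
    (nssi : ℕ) → Strings.IsNss _<ᶜ_ S i nssi →
    (L : ℕ → List A) → (∀ k → k < length S → Strings.LongestLyndonPrefix _<ᶜ_ S k (L k)) →
    (L i ≡ Strings.sub _<ᶜ_ S i nssi)
    × (Strings.sub _<ᶜ_ S i nssi ≡ Strings.sub _<ᶜ_ S i (suc i) ++ Strings.segments _<ᶜ_ S cs nssi)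
    × (Strings.sub _<ᶜ_ S i (suc i) ++ Strings.segments _<ᶜ_ S cs nssi ≡ Strings.sub _<ᶜ_ S i (suc i) ++ Strings.concatMap′ _<ᶜ_ L cs)
lemma4 _<ᶜ_ sto S _ _ _ _ _ i i<n cs increasing children j i-nss@(i<j , j≤n , Sj≺Si , below-j) L L-longest =
  longestLyndonPrefix-ends-at-nss i-nss (L-longest i i<n) ,
  sym (trans (cong (sub S i (suc i) ++_) (segments-NssChain chain)) (sub-++ (n≤1+n i) i<j)) ,
  cong (sub S i (suc i) ++_) (sym (concatMap-NssChain L L-longest chain))
  where
  open Strings _<ᶜ_
  open Suffixes _<ᶜ_ sto S
  open Children i<j j≤n Sj≺Si below-j
  childrenFrom-suc : ChildrenFrom (suc i) cs
  childrenFrom-suc = record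
    { increasing = increasing
    ; sound      = λ k∈cs → let k-child = Equivalence.to (children _) k∈cs in k-child , proj₁ (proj₂ k-child)
    ; complete   = λ k-child _ → Equivalence.from (children _) k-child
    }
  chain : NssChain (suc i) cs
  chain = children-NssChain childrenFrom-suc (map₁ suc-isChild (m≤n⇒m<n∨m≡n i<j))
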